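{- Let $G$ be a proper interval graph with $n$ vertices and $k$ cut-vertices. Then $meg(G)=n-k$.
   Context: All graphs are finite and simple. An interval graph is the intersection graph of a family of intervals of the real line (vertices correspond to intervals, adjacent iff the intervals intersect); it is a proper interval graph if the intervals can be chosen so that none contains another. A pair of vertices $u,v$ (or any vertex set containing them) monitors an edge $e$ if $e$ lies on every shortest $u$–$v$ path. A monitoring edge-geodetic set (MEG-set) of $G$ is a set $M\subseteq V(G)$ such that every edge of $G$ is monitored by some pair of vertices of $M$; $meg(G)$ is the minimum size of an MEG-set. -}

module Defs where

open import Data.Nat using (ℕ; _≤_; _∸_)
open import Data.Fin using (Fin)
open import Data.Fin.Subset using (Subset; _∈_; ∣_∣)
open import Data.Bool using (Bool; true)
open import Data.Product using (_×_; ∃; ∃-syntax; Σ-syntax)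
open import Data.Sum using (_⊎_)
open import Data.Rational as ℚ using (ℚ)
open import Relation.Binary.PropositionalEquality using (_≡_; _≢_)
open import Relation.Nullary using (¬_)
open import Function.Bundles using (_⇔_)

record Graph (n : ℕ) : Set where
  field
    adj    : Fin n → Fin n → Bool
    sym    : ∀ u v → adj u v ≡ adj v u
    irrefl : ∀ u → ¬ (adj u u ≡ true)

open Graph public

module _ {n : ℕ} (G : Graph n) where

  Adj : Fin n → Fin n → Set
  Adj u v = adj G u v ≡ true

  data Walk : Fin n → Fin n → Set where
    []  : ∀ {u} → Walk u u
    _∷_ : ∀ {u w v} → Adj u w → Walk w v → Walk u v

  len : ∀ {u v} → Walk u v → ℕ
  len []      = 0
  len (_ ∷ p) = Data.Nat.suc (len p)

  data EdgeOn (a b : Fin n) : ∀ {u v} → Walk u v → Set where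
    here→ : ∀ {v} (e : Adj a b) (p : Walk b v) → EdgeOn a b (e ∷ p)
    here← : ∀ {v} (e : Adj b a) (p : Walk a v) → EdgeOn a b (e ∷ p)
    there : ∀ {u w v} (e : Adj u w) {p : Walk w v} → EdgeOn a b p → EdgeOn a b (e ∷ p)

  data Avoids (x : Fin n) : ∀ {u v} → Walk u v → Set where
    []  : ∀ {u} → u ≢ x → Avoids x ([] {u})
    _∷_ : ∀ {u w v} {e : Adj u w} {p : Walk w v} → u ≢ x → Avoids x p → Avoids x (e ∷ p)

  -- shortest u–v paths (a shortest walk is automatically a path)
  IsShortest : ∀ {u v} → Walk u v → Set
  IsShortest {u} {v} p = ∀ (q : Walk u v) → len p ≤ len q

  Monitors : Fin n → Fin n → Fin n → Fin n → Set
  Monitors u v a b = ∀ (p : Walk u v) → IsShortest p → EdgeOn a b p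

  IsMEG : Subset n → Set
  IsMEG M = ∀ a b → Adj a b → ∃[ u ] ∃[ v ] (u ∈ M × v ∈ M × Monitors u v a b)

  MegIs : ℕ → Set
  MegIs m = (∃[ M ] (IsMEG M × ∣ M ∣ ≡ m)) × (∀ M → IsMEG M → m ≤ ∣ M ∣)

  Connected : Set
  Connected = ∀ u v → Walk u v

  IsCutVertex : Fin n → Set
  IsCutVertex x = ∃[ a ] ∃[ b ] (a ≢ x × b ≢ x × Walk a b ×
                    ¬ (Σ[ p ∈ Walk a b ] Avoids x p))

  -- proper interval graph: closed intervals [l v, r v] of rational numbers,
  -- adjacency = intersection, and no interval contains another
  IsProperInterval : Set
  IsProperInterval =
    Σ[ l ∈ (Fin n → ℚ) ] Σ[ r ∈ (Fin n → ℚ) ] ((∀ v → l v ℚ.≤ r v) ×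
      (∀ u v → u ≢ v → (Adj u v ⇔ (l u ℚ.≤ r v × l v ℚ.≤ r u))) ×
      (∀ u v → u ≢ v → ¬ (l u ℚ.≤ l v × r v ℚ.≤ r u)))

{-# OPTIONS --safe #-}
module Submission where

-- Order the vertices by left endpoint.  Properness makes the right endpoints
-- increase along this order too, so an edge joins every pair of vertices lying
-- between its ends.  Consequently a vertex c is a cut vertex exactly when it has
-- vertices on both sides and no edge straddles it, and then every walk from one
-- side of c to the other passes through c.
--
-- Upper bound: for an edge ab with a left of b, let u be a, or the leftmost
-- vertex if a is a cut vertex, and symmetrically w for b.  Every u–w walk passes
-- through a and later through b, so every shortest u–w path uses the edge ab.
--
-- Lower bound: a non-cut vertex v has an edge vw (w the right end of an edge
-- straddling v, or any neighbour if v is extreme) such that every path x–v–z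
-- can be replaced by an x–z walk of length at most 2 not using vw.  Rerouting a
-- shortest path between two vertices other than v in this way yields a shortest
-- path missing vw, so v lies in every MEG-set.

open import Defs
open import Data.Nat using (ℕ; zero; suc; _+_; _≤_; _∸_; _<_; z≤n; s≤s)
import Data.Nat.Properties as ℕP
open import Data.Fin using (Fin; zero; suc; _≟_)
open import Data.Fin.Properties using (any?)
open import Data.Fin.Subset using (Subset; _∈_; _∉_; ∣_∣; ∁)
open import Data.Fin.Subset.Properties
  using (_∈?_; p⊆q⇒∣p∣≤∣q∣; x∈∁p⇒x∉p; x∉p⇒x∈∁p; ∣∁p∣≡n∸∣p∣)
open import Data.Bool using (true)
import Data.Bool.Properties as 𝔹P
open import Data.List using (allFin)
open import Data.List.Relation.Unary.All using (lookup)
open import Data.List.Membership.Propositional.Properties using (∈-allFin)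
open import Data.Rational as ℚ using (ℚ)
import Data.Rational.Properties as ℚP
open import Data.Product using (Σ; _×_; _,_; proj₂; ∃-syntax; Σ-syntax)
open import Data.Sum using (_⊎_; inj₁; inj₂; [_,_]′)
import Data.Sum as Sum
open import Data.Empty using (⊥; ⊥-elim)
open import Relation.Binary.Bundles using (DecTotalOrder)
open import Data.List.Extrema (DecTotalOrder.totalOrder ℚP.≤-decTotalOrder)
  using (argmin; argmax; f[argmin]≤f[xs]; f[xs]≤f[argmax])
open import Relation.Binary.PropositionalEquality
  using (_≡_; _≢_; refl; trans; cong; subst; subst₂; ≢-sym)
  renaming (sym to ≡-sym)
open import Relation.Binary.Definitions using (tri<; tri≈; tri>)
open import Relation.Nullary using (¬_; Dec; yes; no)
open import Relation.Nullary.Decidable using (_×-dec_)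
open import Function.Base using (_∘_)
open import Function.Bundles using (_⇔_; Equivalence)

module Walks {n : ℕ} (G : Graph n) where

  Adj-sym : ∀ {x y} → Adj G x y → Adj G y x
  Adj-sym {x} {y} e = trans (Graph.sym G y x) e

  Adj⇒≢ : ∀ {x y} → Adj G x y → x ≢ y
  Adj⇒≢ {x} e refl = irrefl G x e

  adj? : ∀ x y → Dec (Adj G x y)
  adj? x y = adj G x y 𝔹P.≟ true

  has-neighbour : Connected G → ∀ {x y} → x ≢ y → ∃[ w ] Adj G x w
  has-neighbour conn {x} {y} x≢y with conn x y
  ... | []    = ⊥-elim (x≢y refl)
  ... | e ∷ _ = _ , e

  infixr 5 _++_
  _++_ : ∀ {x y z} → Walk G x y → Walk G y z → Walk G x z
  []      ++ q = q
  (e ∷ p) ++ q = e ∷ (p ++ q)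

  ++-identityʳ : ∀ {x y} (p : Walk G x y) → p ++ [] ≡ p
  ++-identityʳ []      = refl
  ++-identityʳ (e ∷ p) = cong (e ∷_) (++-identityʳ p)

  len-++ : ∀ {x y z} (p : Walk G x y) (q : Walk G y z) → len G (p ++ q) ≡ len G p + len G q
  len-++ []      q = refl
  len-++ (e ∷ p) q = cong suc (len-++ p q)

  EdgeOn-++ˡ : ∀ {a b x y z} {p : Walk G x y} (q : Walk G y z) → EdgeOn G a b p → EdgeOn G a b (p ++ q)
  EdgeOn-++ˡ q (here→ e p) = here→ e (p ++ q)
  EdgeOn-++ˡ q (here← e p) = here← e (p ++ q)
  EdgeOn-++ˡ q (there e h) = there e (EdgeOn-++ˡ q h)

  EdgeOn-++ʳ : ∀ {a b x y z} (p : Walk G x y) {q : Walk G y z} → EdgeOn G a b q → EdgeOn G a b (p ++ q)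
  EdgeOn-++ʳ []      h = h
  EdgeOn-++ʳ (e ∷ p) h = there e (EdgeOn-++ʳ p h)

  EdgeOn-++⁻ : ∀ {a b x y z} (p : Walk G x y) {q : Walk G y z} →
               EdgeOn G a b (p ++ q) → EdgeOn G a b p ⊎ EdgeOn G a b q
  EdgeOn-++⁻ []      h           = inj₂ h
  EdgeOn-++⁻ (e ∷ p) (here→ _ _) = inj₁ (here→ e p)
  EdgeOn-++⁻ (e ∷ p) (here← _ _) = inj₁ (here← e p)
  EdgeOn-++⁻ (e ∷ p) (there _ h) = Sum.map₁ (there e) (EdgeOn-++⁻ p h)

  EdgeOn-swap : ∀ {a b x y} {p : Walk G x y} → EdgeOn G a b p → EdgeOn G b a p
  EdgeOn-swap (here→ e p) = here← e p
  EdgeOn-swap (here← e p) = here→ e p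
  EdgeOn-swap (there e h) = there e (EdgeOn-swap h)

  Avoids⇒¬EdgeOn : ∀ {a b x y} {p : Walk G x y} → Avoids G a p → ¬ EdgeOn G a b p
  Avoids⇒¬EdgeOn (x≢a ∷ _)          (here→ _ _) = x≢a refl
  Avoids⇒¬EdgeOn (_ ∷ [] y≢a)       (here← _ _) = y≢a refl
  Avoids⇒¬EdgeOn (_ ∷ (y≢a ∷ _))    (here← _ _) = y≢a refl
  Avoids⇒¬EdgeOn (_ ∷ avoids)       (there _ h) = Avoids⇒¬EdgeOn avoids h

  ¬EdgeOn-via : ∀ {a b x y z} {e₁ : Adj G x y} {e₂ : Adj G y z} →
                x ≢ a → x ≢ b → z ≢ a → z ≢ b → ¬ EdgeOn G a b (e₁ ∷ (e₂ ∷ []))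
  ¬EdgeOn-via x≢a _ _ _ (here→ _ _)           = x≢a refl
  ¬EdgeOn-via _ x≢b _ _ (here← _ _)           = x≢b refl
  ¬EdgeOn-via _ _ _ z≢b (there _ (here→ _ _)) = z≢b refl
  ¬EdgeOn-via _ _ z≢a _ (there _ (here← _ _)) = z≢a refl

  Avoids-head : ∀ {c x y} {p : Walk G x y} → Avoids G c p → x ≢ c
  Avoids-head ([] x≢c) = x≢c
  Avoids-head (x≢c ∷ _) = x≢c

  Avoids-++ : ∀ {c x y z} {p : Walk G x y} {q : Walk G y z} →
              Avoids G c p → Avoids G c q → Avoids G c (p ++ q)
  Avoids-++ ([] _)           avoids-q = avoids-q
  Avoids-++ (x≢c ∷ avoids-p) avoids-q = x≢c ∷ Avoids-++ avoids-p avoids-q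

  ¬Avoids-through : ∀ {c x y} (p : Walk G x c) (q : Walk G c y) → ¬ Avoids G c (p ++ q)
  ¬Avoids-through []      q avoids        = Avoids-head avoids refl
  ¬Avoids-through (e ∷ p) q (_ ∷ avoids)  = ¬Avoids-through p q avoids

  PassesThrough : ∀ {x y} → Fin n → Walk G x y → Set
  PassesThrough {x} {y} c p = Σ[ p₁ ∈ Walk G x c ] Σ[ p₂ ∈ Walk G c y ] p ≡ p₁ ++ p₂

  shortest-++ʳ : ∀ {x y z} (p : Walk G x y) (q : Walk G y z) → IsShortest G (p ++ q) → IsShortest G q
  shortest-++ʳ p q shortest q′ = ℕP.+-cancelˡ-≤ (len G p) _ _
    (subst₂ _≤_ (len-++ p q) (len-++ p q′) (shortest (p ++ q′)))

  shortest-++ˡ : ∀ {x y z} (p : Walk G x y) (q : Walk G y z) → IsShortest G (p ++ q) → IsShortest G p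
  shortest-++ˡ p q shortest p′ = ℕP.+-cancelʳ-≤ (len G q) _ _
    (subst₂ _≤_ (len-++ p q) (len-++ p′ q) (shortest (p′ ++ q)))

  shortest-edge : ∀ {a b} → Adj G a b → (p : Walk G a b) → IsShortest G p → EdgeOn G a b p
  shortest-edge e []                 _        = ⊥-elim (Adj⇒≢ e refl)
  shortest-edge e (e′ ∷ [])          _        = here→ e′ []
  shortest-edge e (e′ ∷ (_ ∷ _))     shortest with shortest (e ∷ [])
  ... | s≤s ()

  shortest-through-edge : ∀ {a b u w} → Adj G a b →
                          (p₁ : Walk G u a) (p₂ : Walk G a b) (p₃ : Walk G b w) →
                          IsShortest G (p₁ ++ p₂ ++ p₃) → EdgeOn G a b (p₁ ++ p₂ ++ p₃)
  shortest-through-edge e p₁ p₂ p₃ shortest =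
    EdgeOn-++ʳ p₁ (EdgeOn-++ˡ p₃ (shortest-edge e p₂
      (shortest-++ˡ p₂ p₃ (shortest-++ʳ p₁ (p₂ ++ p₃) shortest))))

  -- Only the double negation is constructive: shortness quantifies over all walks.
  ¬¬shortest : ∀ {x y} → Walk G x y → ¬ ¬ Σ (Walk G x y) (IsShortest G)
  ¬¬shortest {x} {y} p none = below (suc (len G p)) p ℕP.≤-refl
    where
    below : ∀ k (q : Walk G x y) → len G q < k → ⊥
    below (suc k) q (s≤s q≤k) = none (q , shortest)
      where
      shortest : IsShortest G q
      shortest q′ with len G q ℕP.≤? len G q′
      ... | yes q≤q′ = q≤q′
      ... | no q≰q′  = ⊥-elim (below k q′ (ℕP.≤-trans (ℕP.≰⇒> q≰q′) q≤k))

  -- Good q m reads: q may replace a walk of length m.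
  module Reroute (c : Fin n) (Good : ∀ {x y} → Walk G x y → ℕ → Set)
    (good-[] : ∀ {x} → x ≢ c → Good ([] {u = x}) 0)
    (good-edge : ∀ {x y} (e : Adj G x y) → x ≢ c → y ≢ c → Good (e ∷ []) 1)
    (good-++ : ∀ {x y z} {p : Walk G x y} {q : Walk G y z} {i j} →
               Good p i → Good q j → Good (p ++ q) (i + j))
    (detour : ∀ {x z} → x ≢ c → z ≢ c → Adj G x c → Adj G c z → Σ[ r ∈ Walk G x z ] Good r 2)
    where

    reroute : ∀ {x y} (p : Walk G x y) → x ≢ c → y ≢ c → Σ[ q ∈ Walk G x y ] Good q (len G p)
    reroute [] x≢c _ = [] , good-[] x≢c
    reroute (_∷_ {w = w} e p) x≢c y≢c with w ≟ c
    reroute (_∷_ {w = w} e p) x≢c y≢c | no w≢c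
      with q , good-q ← reroute p w≢c y≢c = e ∷ q , good-++ (good-edge e x≢c w≢c) good-q
    reroute (e ∷ [])       x≢c y≢c | yes refl = ⊥-elim (y≢c refl)
    reroute (e ∷ (e′ ∷ p)) x≢c y≢c | yes refl
      with r , good-r ← detour x≢c (≢-sym (Adj⇒≢ e′)) e e′
         | q , good-q ← reroute p (≢-sym (Adj⇒≢ e′)) y≢c = r ++ q , good-++ good-r good-q

  EdgeDetours : Fin n → Fin n → Set
  EdgeDetours v w = ∀ {x z} → x ≢ v → z ≢ v → Adj G x v → Adj G v z →
                    Σ[ r ∈ Walk G x z ] (¬ EdgeOn G v w r × len G r ≤ 2)

  detours⇒∈MEG : Connected G → ∀ {v w} → Adj G v w → EdgeDetours v w →
                 ∀ {M} → IsMEG G M → v ∈ M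
  detours⇒∈MEG conn {v} {w} vw detours {M} meg
    with x , y , x∈M , y∈M , monitors ← meg v w vw
    with v ∈? M
  ... | yes v∈M = v∈M
  ... | no v∉M  = ⊥-elim (¬¬shortest (conn x y) no-shortest-path)
    where
    Missing : ∀ {a b} → Walk G a b → ℕ → Set
    Missing r m = ¬ EdgeOn G v w r × len G r ≤ m

    missing-++ : ∀ {a b c} {p : Walk G a b} {q : Walk G b c} {i j} →
                 Missing p i → Missing q j → Missing (p ++ q) (i + j)
    missing-++ {p = p} {q} (¬vw∈p , p≤i) (¬vw∈q , q≤j) =
      [ ¬vw∈p , ¬vw∈q ]′ ∘ EdgeOn-++⁻ p ,
      subst (_≤ _) (≡-sym (len-++ p q)) (ℕP.+-mono-≤ p≤i q≤j)

    open Reroute v Missing (λ _ → (λ ()) , z≤n)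
      (λ _ x≢v y≢v → Avoids⇒¬EdgeOn (x≢v ∷ [] y≢v) , ℕP.≤-refl) missing-++ detours

    avoids-v : ∀ {u} → u ∈ M → u ≢ v
    avoids-v u∈M refl = v∉M u∈M

    no-shortest-path : ¬ Σ (Walk G x y) (IsShortest G)
    no-shortest-path (p , shortest)
      with q , ¬vw∈q , q≤p ← reroute p (avoids-v x∈M) (avoids-v y∈M) =
      ¬vw∈q (monitors q (λ q′ → ℕP.≤-trans q≤p (shortest q′)))

module ProperInterval {n : ℕ} (G : Graph n) (l r : Fin n → ℚ)
  (l≤r : ∀ v → l v ℚ.≤ r v)
  (adj⇔ : ∀ u v → u ≢ v → (Adj G u v ⇔ (l u ℚ.≤ r v × l v ℚ.≤ r u)))
  (proper : ∀ u v → u ≢ v → ¬ (l u ℚ.≤ l v × r v ℚ.≤ r u)) where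

  open Walks G

  infix 4 _≺_ _≼_
  _≺_ _≼_ : Fin n → Fin n → Set
  x ≺ y = l x ℚ.< l y
  x ≼ y = l x ℚ.≤ l y

  ≺⇒≢ : ∀ {x y} → x ≺ y → x ≢ y
  ≺⇒≢ x≺y refl = ℚP.<-irrefl refl x≺y

  ≼⇒⊀ : ∀ {x y} → x ≼ y → ¬ y ≺ x
  ≼⇒⊀ x≼y y≺x = ℚP.<-irrefl refl (ℚP.≤-<-trans x≼y y≺x)

  l-injective : ∀ {x y} → l x ≡ l y → x ≡ y
  l-injective {x} {y} lx≡ly with x ≟ y
  ... | yes x≡y = x≡y
  ... | no x≢y with ℚP.≤-total (r x) (r y)
  ...   | inj₁ rx≤ry = ⊥-elim (proper y x (≢-sym x≢y) (ℚP.≤-reflexive (≡-sym lx≡ly) , rx≤ry))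
  ...   | inj₂ ry≤rx = ⊥-elim (proper x y x≢y (ℚP.≤-reflexive lx≡ly , ry≤rx))

  trichotomy : ∀ x y → x ≡ y ⊎ x ≺ y ⊎ y ≺ x
  trichotomy x y with ℚP.<-cmp (l x) (l y)
  ... | tri< x≺y _ _ = inj₂ (inj₁ x≺y)
  ... | tri≈ _ lx≡ly _ = inj₁ (l-injective lx≡ly)
  ... | tri> _ _ y≺x = inj₂ (inj₂ y≺x)

  r-mono : ∀ {x y} → x ≼ y → r x ℚ.≤ r y
  r-mono {x} {y} x≼y with x ≟ y | ℚP.≤-total (r x) (r y)
  ... | yes refl | _          = ℚP.≤-refl
  ... | no _     | inj₁ rx≤ry = rx≤ry
  ... | no x≢y   | inj₂ ry≤rx = ⊥-elim (proper x y x≢y (x≼y , ry≤rx))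

  umbrella : ∀ {u v x y} → u ≺ v → Adj G u v → u ≼ x → x ≺ y → y ≼ v → Adj G x y
  umbrella {u} {v} {x} {y} u≺v uv u≼x x≺y y≼v = Equivalence.from (adj⇔ x y (≺⇒≢ x≺y))
    ( ℚP.≤-trans (ℚP.<⇒≤ x≺y) (l≤r y)
    , ℚP.≤-trans y≼v (ℚP.≤-trans (proj₂ (Equivalence.to (adj⇔ u v (≺⇒≢ u≺v)) uv)) (r-mono u≼x)))

  Near : Fin n → Fin n → Set
  Near x y = x ≡ y ⊎ Adj G x y

  near-left : ∀ {v x z} → x ≺ v → z ≺ v → Adj G x v → Adj G z v → Near x z
  near-left {v} {x} {z} x≺v z≺v xv zv with trichotomy x z
  ... | inj₁ x≡z        = inj₁ x≡z
  ... | inj₂ (inj₁ x≺z) = inj₂ (umbrella x≺v xv ℚP.≤-refl x≺z (ℚP.<⇒≤ z≺v))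
  ... | inj₂ (inj₂ z≺x) = inj₂ (Adj-sym (umbrella z≺v zv ℚP.≤-refl z≺x (ℚP.<⇒≤ x≺v)))

  near-right : ∀ {v x z} → v ≺ x → v ≺ z → Adj G v x → Adj G v z → Near x z
  near-right {v} {x} {z} v≺x v≺z vx vz with trichotomy x z
  ... | inj₁ x≡z        = inj₁ x≡z
  ... | inj₂ (inj₁ x≺z) = inj₂ (umbrella v≺z vz (ℚP.<⇒≤ v≺x) x≺z ℚP.≤-refl)
  ... | inj₂ (inj₂ z≺x) = inj₂ (Adj-sym (umbrella v≺x vx (ℚP.<⇒≤ v≺z) z≺x ℚP.≤-refl))

  data TwoPath (v x z : Fin n) : Set where
    shortcut : Near x z → TwoPath v x z
    rising   : x ≺ v → v ≺ z → TwoPath v x z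
    falling  : z ≺ v → v ≺ x → TwoPath v x z

  two-path : ∀ {v x z} → Adj G x v → Adj G v z → TwoPath v x z
  two-path {v} {x} {z} xv vz with trichotomy x v | trichotomy z v
  ... | inj₁ x≡v        | _               = ⊥-elim (Adj⇒≢ xv x≡v)
  ... | _               | inj₁ z≡v        = ⊥-elim (Adj⇒≢ vz (≡-sym z≡v))
  ... | inj₂ (inj₁ x≺v) | inj₂ (inj₁ z≺v) = shortcut (near-left x≺v z≺v xv (Adj-sym vz))
  ... | inj₂ (inj₁ x≺v) | inj₂ (inj₂ v≺z) = rising x≺v v≺z
  ... | inj₂ (inj₂ v≺x) | inj₂ (inj₁ z≺v) = falling z≺v v≺x
  ... | inj₂ (inj₂ v≺x) | inj₂ (inj₂ v≺z) = shortcut (near-right v≺x v≺z (Adj-sym xv) vz)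

  near-walk : ∀ {x y} → Near x y → Walk G x y
  near-walk (inj₁ refl) = []
  near-walk (inj₂ e)    = e ∷ []

  len-near-walk : ∀ {x y} (h : Near x y) → len G (near-walk h) ≤ 1
  len-near-walk (inj₁ refl) = z≤n
  len-near-walk (inj₂ e)    = ℕP.≤-refl

  near-walk-avoids : ∀ {c x y} → x ≢ c → y ≢ c → (h : Near x y) → Avoids G c (near-walk h)
  near-walk-avoids x≢c _   (inj₁ refl) = [] x≢c
  near-walk-avoids x≢c y≢c (inj₂ e)    = x≢c ∷ [] y≢c

  Straddled Leftmost Rightmost Bypassable : Fin n → Set
  Straddled c  = ∃[ s ] ∃[ t ] (s ≺ c × c ≺ t × Adj G s t)
  Leftmost c   = ∀ u → ¬ u ≺ c
  Rightmost c  = ∀ u → ¬ c ≺ u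
  Bypassable c = Leftmost c ⊎ Rightmost c ⊎ Straddled c

  straddled? : ∀ c → Dec (Straddled c)
  straddled? c = any? λ s → any? λ t → (l s ℚP.<? l c) ×-dec (l c ℚP.<? l t) ×-dec adj? s t

  straddler-adjˡ : ∀ {s c t} → s ≺ c → c ≺ t → Adj G s t → Adj G s c
  straddler-adjˡ s≺c c≺t st = umbrella (ℚP.<-trans s≺c c≺t) st ℚP.≤-refl s≺c (ℚP.<⇒≤ c≺t)

  straddler-adjʳ : ∀ {s c t} → s ≺ c → c ≺ t → Adj G s t → Adj G c t
  straddler-adjʳ s≺c c≺t st = umbrella (ℚP.<-trans s≺c c≺t) st (ℚP.<⇒≤ s≺c) c≺t ℚP.≤-refl

  inner⇒straddled : ∀ {c x z} → Bypassable c → x ≺ c → c ≺ z → Straddled c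
  inner⇒straddled (inj₁ leftmost)          x≺c _   = ⊥-elim (leftmost _ x≺c)
  inner⇒straddled (inj₂ (inj₁ rightmost))  _   c≺z = ⊥-elim (rightmost _ c≺z)
  inner⇒straddled (inj₂ (inj₂ straddled))  _   _   = straddled

  detour-via : ∀ {c x s t z} → x ≢ c → s ≢ c → t ≢ c → z ≢ c →
               Near x s → Adj G s t → Near t z → Σ[ r ∈ Walk G x z ] Avoids G c r
  detour-via x≢c s≢c t≢c z≢c xs st tz =
    near-walk xs ++ st ∷ near-walk tz ,
    Avoids-++ (near-walk-avoids x≢c s≢c xs) (s≢c ∷ near-walk-avoids t≢c z≢c tz)

  avoiding-detour : ∀ {c x z} → Bypassable c → x ≢ c → z ≢ c → Adj G x c → Adj G c z →
                    Σ[ r ∈ Walk G x z ] Avoids G c r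
  avoiding-detour bypassable x≢c z≢c xc cz with two-path xc cz
  ... | shortcut xz = near-walk xz , near-walk-avoids x≢c z≢c xz
  ... | rising x≺c c≺z
    with s , t , s≺c , c≺t , st ← inner⇒straddled bypassable x≺c c≺z =
    detour-via x≢c (≺⇒≢ s≺c) (≢-sym (≺⇒≢ c≺t)) z≢c
      (near-left x≺c s≺c xc (straddler-adjˡ s≺c c≺t st)) st
      (near-right c≺t c≺z (straddler-adjʳ s≺c c≺t st) cz)
  ... | falling z≺c c≺x
    with s , t , s≺c , c≺t , st ← inner⇒straddled bypassable z≺c c≺x =
    detour-via x≢c (≢-sym (≺⇒≢ c≺t)) (≺⇒≢ s≺c) z≢c
      (near-right c≺x c≺t (Adj-sym xc) (straddler-adjʳ s≺c c≺t st)) (Adj-sym st)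
      (near-left s≺c z≺c (straddler-adjˡ s≺c c≺t st) (Adj-sym cz))

  bypassable⇒¬cut : ∀ {c} → Bypassable c → ¬ IsCutVertex G c
  bypassable⇒¬cut {c} bypassable (a , b , a≢c , b≢c , p , no-avoiding) =
    no-avoiding (reroute p a≢c b≢c)
    where
    open Reroute c (λ q _ → Avoids G c q) [] (λ _ x≢c y≢c → x≢c ∷ [] y≢c) Avoids-++
      (avoiding-detour bypassable)

  passes-through : ∀ {c x y} → ¬ Straddled c → (p : Walk G x y) → x ≼ c → c ≼ y → PassesThrough c p
  passes-through ¬straddled [] x≼c c≼x
    with refl ← l-injective (ℚP.≤-antisym x≼c c≼x) = [] , [] , refl
  passes-through {c} {x} ¬straddled (_∷_ {w = w} e p) x≼c c≼y with trichotomy x c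
  ... | inj₁ refl       = [] , e ∷ p , refl
  ... | inj₂ (inj₂ c≺x) = ⊥-elim (≼⇒⊀ x≼c c≺x)
  ... | inj₂ (inj₁ x≺c) with l c ℚP.<? l w
  ...   | yes c≺w = ⊥-elim (¬straddled (x , w , x≺c , c≺w , e))
  ...   | no c⊀w
    with p₁ , p₂ , refl ← passes-through ¬straddled p (ℚP.≮⇒≥ c⊀w) c≼y = e ∷ p₁ , p₂ , refl

  unstraddled⇒cut : Connected G → ∀ {c x y} → x ≺ c → c ≺ y → ¬ Straddled c → IsCutVertex G c
  unstraddled⇒cut conn {c} {x} {y} x≺c c≺y ¬straddled =
    x , y , ≺⇒≢ x≺c , ≢-sym (≺⇒≢ c≺y) , conn x y , no-avoiding
    where
    no-avoiding : ¬ (Σ[ p ∈ Walk G x y ] Avoids G c p)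
    no-avoiding (p , avoids)
      with p₁ , p₂ , refl ← passes-through ¬straddled p (ℚP.<⇒≤ x≺c) (ℚP.<⇒≤ c≺y) =
      ¬Avoids-through p₁ p₂ avoids

  ¬cut⇒bypassable : Connected G → ∀ {c} → ¬ IsCutVertex G c → Bypassable c
  ¬cut⇒bypassable conn {c} ¬cut
    with any? (λ u → l u ℚP.<? l c) | any? (λ u → l c ℚP.<? l u) | straddled? c
  ... | no none-left | _             | _              = inj₁ λ u u≺c → none-left (u , u≺c)
  ... | _            | no none-right | _              = inj₂ (inj₁ λ u c≺u → none-right (u , c≺u))
  ... | _            | _             | yes straddled  = inj₂ (inj₂ straddled)
  ... | yes (x , x≺c) | yes (y , c≺y) | no ¬straddled =
    ⊥-elim (¬cut (unstraddled⇒cut conn x≺c c≺y ¬straddled))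

  leftmost-vertex : Fin n → ∃[ m ] Leftmost m
  leftmost-vertex v₀ = m , λ u → ≼⇒⊀ (lookup (f[argmin]≤f[xs] v₀ (allFin n)) (∈-allFin u))
    where
    m : Fin n
    m = argmin l v₀ (allFin n)

  rightmost-vertex : Fin n → ∃[ m ] Rightmost m
  rightmost-vertex v₀ = m , λ u → ≼⇒⊀ (lookup (f[xs]≤f[argmax] v₀ (allFin n)) (∈-allFin u))
    where
    m : Fin n
    m = argmax l v₀ (allFin n)

  short-detour : ∀ {v w x z} → x ≢ v → z ≢ v → (h : Near x z) →
                 ¬ EdgeOn G v w (near-walk h) × len G (near-walk h) ≤ 2
  short-detour x≢v z≢v h =
    Avoids⇒¬EdgeOn (near-walk-avoids x≢v z≢v h) , ℕP.m≤n⇒m≤1+n (len-near-walk h)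

  extreme-detours : ∀ {v} → Leftmost v ⊎ Rightmost v → ∀ {w} → EdgeDetours v w
  extreme-detours extreme x≢v z≢v xv vz with two-path xv vz | extreme
  ... | shortcut xz     | _               = near-walk xz , short-detour x≢v z≢v xz
  ... | rising x≺v _    | inj₁ leftmost   = ⊥-elim (leftmost _ x≺v)
  ... | rising _ v≺z    | inj₂ rightmost  = ⊥-elim (rightmost _ v≺z)
  ... | falling z≺v _   | inj₁ leftmost   = ⊥-elim (leftmost _ z≺v)
  ... | falling _ v≺x   | inj₂ rightmost  = ⊥-elim (rightmost _ v≺x)

  through-v : ∀ {v w x z} → x ≢ v → x ≢ w → z ≢ v → z ≢ w → Adj G x v → Adj G v z →
              Σ[ r ∈ Walk G x z ] (¬ EdgeOn G v w r × len G r ≤ 2)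
  through-v x≢v x≢w z≢v z≢w xv vz = xv ∷ (vz ∷ []) , ¬EdgeOn-via x≢v x≢w z≢v z≢w , ℕP.≤-refl

  -- A path x–v–z may keep going through v unless it would use the edge vt;
  -- in that case the straddling edge st leads around v.
  module _ {s v t : Fin n} (s≺v : s ≺ v) (v≺t : v ≺ t) (st : Adj G s t) where

    private
      sv : Adj G s v
      sv = straddler-adjˡ s≺v v≺t st

      s≢v : s ≢ v
      s≢v = ≺⇒≢ s≺v

    straddle-detours : EdgeDetours v t
    straddle-detours {x} {z} x≢v z≢v xv vz with two-path xv vz
    ... | shortcut xz = near-walk xz , short-detour x≢v z≢v xz
    ... | rising x≺v v≺z with _ ≟ t
    ...   | no z≢t = through-v x≢v (≺⇒≢ (ℚP.<-trans x≺v v≺t)) z≢v z≢t xv vz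
    ...   | yes refl =
      near-walk xs ++ st ∷ [] ,
      Avoids⇒¬EdgeOn (Avoids-++ (near-walk-avoids x≢v s≢v xs) (s≢v ∷ [] z≢v)) ,
      subst (_≤ 2) (≡-sym (len-++ (near-walk xs) (st ∷ []))) (ℕP.+-monoˡ-≤ 1 (len-near-walk xs))
      where
      xs : Near x s
      xs = near-left x≺v s≺v xv sv
    straddle-detours {x} {z} x≢v z≢v xv vz | falling z≺v v≺x with _ ≟ t
    ... | no x≢t = through-v x≢v x≢t z≢v (≺⇒≢ (ℚP.<-trans z≺v v≺t)) xv vz
    ... | yes refl =
      Adj-sym st ∷ near-walk sz ,
      Avoids⇒¬EdgeOn (x≢v ∷ near-walk-avoids s≢v z≢v sz) ,
      s≤s (len-near-walk sz)
      where
      sz : Near s z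
      sz = near-left s≺v z≺v sv (Adj-sym vz)

  module _ (conn : Connected G) (C : Subset n) (C⇔cut : ∀ (v : Fin n) → (v ∈ C) ⇔ IsCutVertex G v)
           (nontrivial : ∀ (v : Fin n) → ∃[ u ] v ≢ u) where

    ∈C⇒¬bypassable : ∀ {v} → v ∈ C → ¬ Bypassable v
    ∈C⇒¬bypassable {v} v∈C bypassable = bypassable⇒¬cut bypassable (Equivalence.to (C⇔cut v) v∈C)

    ∉C⇒bypassable : ∀ {v} → v ∉ C → Bypassable v
    ∉C⇒bypassable {v} v∉C = ¬cut⇒bypassable conn (v∉C ∘ Equivalence.from (C⇔cut v))

    ∈C⇒¬straddled : ∀ {v} → v ∈ C → ¬ Straddled v
    ∈C⇒¬straddled v∈C = ∈C⇒¬bypassable v∈C ∘ inj₂ ∘ inj₂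

    left-gate : ∀ a → ∃[ u ] (u ∉ C × ∀ {y} (p : Walk G u y) → a ≼ y → PassesThrough a p)
    left-gate a with a ∈? C
    ... | no a∉C = a , a∉C , λ p _ → [] , p , refl
    ... | yes a∈C with m , leftmost ← leftmost-vertex a =
      m , (λ m∈C → ∈C⇒¬bypassable m∈C (inj₁ leftmost)) ,
      λ p a≼y → passes-through (∈C⇒¬straddled a∈C) p (ℚP.≮⇒≥ (leftmost a)) a≼y

    right-gate : ∀ b → ∃[ w ] (w ∉ C × b ≼ w × ∀ {x} (p : Walk G x w) → x ≼ b → PassesThrough b p)
    right-gate b with b ∈? C
    ... | no b∉C = b , b∉C , ℚP.≤-refl , λ p _ → p , [] , ≡-sym (++-identityʳ p)
    ... | yes b∈C with m , rightmost ← rightmost-vertex b =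
      m , (λ m∈C → ∈C⇒¬bypassable m∈C (inj₂ (inj₁ rightmost))) , ℚP.≮⇒≥ (rightmost b) ,
      λ p x≼b → passes-through (∈C⇒¬straddled b∈C) p x≼b (ℚP.≮⇒≥ (rightmost b))

    ∁C-monitors : ∀ {a b} → a ≺ b → Adj G a b →
                  ∃[ u ] ∃[ w ] (u ∈ ∁ C × w ∈ ∁ C × Monitors G u w a b)
    ∁C-monitors {a} {b} a≺b ab
      with u , u∉C , through-a ← left-gate a
         | w , w∉C , b≼w , through-b ← right-gate b =
      u , w , x∉p⇒x∈∁p u∉C , x∉p⇒x∈∁p w∉C , monitors
      where
      monitors : Monitors G u w a b
      monitors p shortest
        with p₁ , p₂ , refl ← through-a p (ℚP.≤-trans (ℚP.<⇒≤ a≺b) b≼w)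
        with p₃ , p₄ , refl ← through-b p₂ (ℚP.<⇒≤ a≺b) =
        shortest-through-edge ab p₁ p₃ p₄ shortest

    ∁C-isMEG : IsMEG G (∁ C)
    ∁C-isMEG a b ab with trichotomy a b
    ... | inj₁ refl       = ⊥-elim (Adj⇒≢ ab refl)
    ... | inj₂ (inj₁ a≺b) = ∁C-monitors a≺b ab
    ... | inj₂ (inj₂ b≺a)
      with u , w , u∈∁C , w∈∁C , monitors ← ∁C-monitors b≺a (Adj-sym ab) =
      u , w , u∈∁C , w∈∁C , λ p shortest → EdgeOn-swap (monitors p shortest)

    non-cut-edge : ∀ {v} → v ∉ C → ∃[ w ] (Adj G v w × EdgeDetours v w)
    non-cut-edge {v} v∉C with ∉C⇒bypassable v∉C | has-neighbour conn (proj₂ (nontrivial v))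
    ... | inj₁ leftmost                        | w , vw = w , vw , extreme-detours (inj₁ leftmost)
    ... | inj₂ (inj₁ rightmost)                | w , vw = w , vw , extreme-detours (inj₂ rightmost)
    ... | inj₂ (inj₂ (s , t , s≺v , v≺t , st)) | _      =
      t , straddler-adjʳ s≺v v≺t st , straddle-detours s≺v v≺t st

    non-cut-∈MEG : ∀ {v} → v ∉ C → ∀ {M} → IsMEG G M → v ∈ M
    non-cut-∈MEG v∉C with w , vw , detours ← non-cut-edge v∉C = detours⇒∈MEG conn vw detours

    meg-is-n∸∣C∣ : MegIs G (n ∸ ∣ C ∣)
    meg-is-n∸∣C∣ =
      (∁ C , ∁C-isMEG , ∣∁p∣≡n∸∣p∣ C) ,
      λ M meg → subst (_≤ ∣ M ∣) (∣∁p∣≡n∸∣p∣ C)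
        (p⊆q⇒∣p∣≤∣q∣ (λ v∈∁C → non-cut-∈MEG (x∈∁p⇒x∉p v∈∁C) meg))

mainTheorem12 : (n : ℕ) (G : Graph n) → 2 ≤ n → Connected G → IsProperInterval G →
    (C : Subset n) → (∀ v → (v ∈ C) ⇔ IsCutVertex G v) →
    MegIs G (n ∸ ∣ C ∣)
mainTheorem12 (suc (suc k)) G (s≤s (s≤s z≤n)) conn (l , r , l≤r , adj⇔ , proper) C C⇔cut =
  meg-is-n∸∣C∣ conn C C⇔cut another-vertex
  where
  open ProperInterval G l r l≤r adj⇔ proper

  another-vertex : ∀ (v : Fin (suc (suc k))) → ∃[ u ] v ≢ u
  another-vertex zero    = suc zero , λ ()
  another-vertex (suc _) = zero , λ ()
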